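{- Let $G=(V,E)$ be a finite graph, $X\subseteq V$, and $Y=\mathcal{S}(X)$. If $\mathcal{S}(Y)=V$, then $D_1(G)\le|X|+3$.
   Context: For a graph $G=(V,E)$ and $X\subseteq V$, define the relation $\equiv_X$ on $V$ by $x\equiv_X y$ iff $x=y$ or ($x,y\in V\setminus X$ and $\Gamma(x)\cap X=\Gamma(y)\cap X$), where $\Gamma$ denotes neighbourhood. Let $\mathcal{S}(X)=\{x\in V:\ \text{there is no }y\in V,\ y\ne x,\ \text{with } y\equiv_X x\}$ (note $X\subseteq\mathcal{S}(X)$). First order sentences about graphs use variables over vertices, relations $=$ and $\sim$ (adjacency), quantifiers $\forall,\exists$, Boolean connectives; quantifier depth is the maximum number of nested quantifiers. A sentence $A$ defines $G$ if $G\models A$ and $H\not\models A$ for all $H\not\cong G$. For a sentence with no quantifier in the scope of a negation, the alternation number is the maximum number of changes between $\exists$ and $\forall$ along a chain of nested quantifiers. $D_1(G)$ is the minimum depth of a sentence with alternation number at most $1$ defining $G$. -}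

module Defs where

open import Data.Nat using (ℕ; zero; suc; _+_; _⊔_; _≤_)
open import Data.Fin using (Fin; zero; suc)
open import Data.Fin.Subset using (Subset; _∈_; _∉_; ∣_∣)
open import Data.Bool using (Bool; true; false)
open import Data.Product using (Σ; _×_; _,_)
open import Data.Sum using (_⊎_)
open import Data.Empty using (⊥)
open import Relation.Nullary using (¬_)
open import Relation.Binary.PropositionalEquality using (_≡_; _≢_)
open import Function.Bundles using (_↔_; Inverse)

record Graph : Set where
  field
    order : ℕ
    adj   : Fin order → Fin order → Bool
    adj-sym   : ∀ x y → adj x y ≡ adj y x
    adj-irr   : ∀ x → adj x x ≡ false
open Graph public

record _≅_ (G H : Graph) : Set where
  field
    bij      : Fin (order G) ↔ Fin (order H)
    preserve : ∀ x y → adj H (Inverse.to bij x) (Inverse.to bij y) ≡ adj G x y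

-- First-order formulas in the language {=, ~}, with k free variables
-- (de Bruijn style, variables are Fin k). Sentences are Formula 0.

data Formula : ℕ → Set where
  eq   : ∀ {k} → Fin k → Fin k → Formula k
  adjF : ∀ {k} → Fin k → Fin k → Formula k
  neg  : ∀ {k} → Formula k → Formula k
  and  : ∀ {k} → Formula k → Formula k → Formula k
  or   : ∀ {k} → Formula k → Formula k → Formula k
  ex   : ∀ {k} → Formula (suc k) → Formula k
  all  : ∀ {k} → Formula (suc k) → Formula k

Sentence : Set
Sentence = Formula 0

extend : ∀ {n k} → (Fin k → Fin n) → Fin n → Fin (suc k) → Fin n
extend ρ v zero    = v
extend ρ v (suc i) = ρ i

Sat : (G : Graph) → ∀ {k} → Formula k → (Fin k → Fin (order G)) → Set
Sat G (eq i j)   ρ = ρ i ≡ ρ j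
Sat G (adjF i j) ρ = adj G (ρ i) (ρ j) ≡ true
Sat G (neg φ)    ρ = ¬ Sat G φ ρ
Sat G (and φ ψ)  ρ = Sat G φ ρ × Sat G ψ ρ
Sat G (or φ ψ)   ρ = Sat G φ ρ ⊎ Sat G ψ ρ
Sat G (ex φ)     ρ = Σ (Fin (order G)) λ v → Sat G φ (extend ρ v)
Sat G (all φ)    ρ = ∀ (v : Fin (order G)) → Sat G φ (extend ρ v)

noVars : ∀ {A : Set} → Fin 0 → A
noVars ()

_⊨_ : Graph → Sentence → Set
G ⊨ A = Sat G A noVars

depth : ∀ {k} → Formula k → ℕ
depth (eq _ _)   = 0
depth (adjF _ _) = 0
depth (neg φ)    = depth φ
depth (and φ ψ)  = depth φ ⊔ depth ψ
depth (or φ ψ)   = depth φ ⊔ depth ψ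
depth (ex φ)     = suc (depth φ)
depth (all φ)    = suc (depth φ)

data QF : ∀ {k} → Formula k → Set where
  qf-eq  : ∀ {k} (i j : Fin k) → QF (eq i j)
  qf-adj : ∀ {k} (i j : Fin k) → QF (adjF i j)
  qf-neg : ∀ {k} {φ : Formula k} → QF φ → QF (neg φ)
  qf-and : ∀ {k} {φ ψ : Formula k} → QF φ → QF ψ → QF (and φ ψ)
  qf-or  : ∀ {k} {φ ψ : Formula k} → QF φ → QF ψ → QF (or φ ψ)

data NegFree : ∀ {k} → Formula k → Set where
  nf-eq  : ∀ {k} (i j : Fin k) → NegFree (eq i j)
  nf-adj : ∀ {k} (i j : Fin k) → NegFree (adjF i j)
  nf-neg : ∀ {k} {φ : Formula k} → QF φ → NegFree (neg φ)
  nf-and : ∀ {k} {φ ψ : Formula k} → NegFree φ → NegFree ψ → NegFree (and φ ψ)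
  nf-or  : ∀ {k} {φ ψ : Formula k} → NegFree φ → NegFree ψ → NegFree (or φ ψ)
  nf-ex  : ∀ {k} {φ : Formula (suc k)} → NegFree φ → NegFree (ex φ)
  nf-all : ∀ {k} {φ : Formula (suc k)} → NegFree φ → NegFree (all φ)

-- Kind of the innermost enclosing quantifier so far (none / ∃ / ∀)
data LastQ : Set where
  none exQ allQ : LastQ

altFrom : LastQ → ∀ {k} → Formula k → ℕ
altFrom q (eq _ _)   = 0
altFrom q (adjF _ _) = 0
altFrom q (neg φ)    = altFrom q φ
altFrom q (and φ ψ)  = altFrom q φ ⊔ altFrom q ψ
altFrom q (or φ ψ)   = altFrom q φ ⊔ altFrom q ψ
altFrom allQ (ex φ)  = suc (altFrom exQ φ)
altFrom q    (ex φ)  = altFrom exQ φ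
altFrom exQ (all φ)  = suc (altFrom allQ φ)
altFrom q   (all φ)  = altFrom allQ φ

alternation : ∀ {k} → Formula k → ℕ
alternation = altFrom none

Defines : Sentence → Graph → Set
Defines A G = (G ⊨ A) × (∀ (H : Graph) → ¬ (H ≅ G) → ¬ (H ⊨ A))

D₁≤ : Graph → ℕ → Set
D₁≤ G d = Σ Sentence λ A →
  NegFree A × (alternation A ≤ 1) × (depth A ≤ d) × Defines A G

EquivX : (G : Graph) → Subset (order G) → Fin (order G) → Fin (order G) → Set
EquivX G X x y =
  (x ≡ y) ⊎ ((x ∉ X) × (y ∉ X) × (∀ z → z ∈ X → adj G x z ≡ adj G y z))

InS : (G : Graph) → Subset (order G) → Fin (order G) → Set
InS G X x = ¬ (Σ (Fin (order G)) λ y → (y ≢ x) × EquivX G X y x)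

{-# OPTIONS --safe #-}
module Submission where

-- Fix an enumeration ξ of X. Given parameters η in a graph H, say that a vertex a of H
-- represents a vertex v of G if a has the same atomic type over η as v over ξ, and a is
-- adjacent to every w whose type over η is that of some y ∈ Y exactly when v ~ y.  The
-- ∃∀-sentence asserts parameters η such that every vertex of G has a representative
-- (∃∀, depth 2) and any two vertices of H are represented by two vertices of G with the
-- same atomic type (∀∀∀, depth 3).  In G, with η = ξ, every vertex represents itself:
-- Y ⊆ S(X) says each y ∈ Y is alone in its type over X.  In a model H every vertex a
-- represents at most one v: two such v, v' have equal type over X, hence are not in
-- S(X) ⊇ Y unless equal, and have the same adjacency to Y (through representatives of
-- the vertices of Y), so v ≡_Y v' and S(Y) = V forces v = v'.  Representation is thus an
-- adjacency-preserving bijection from H onto G.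

open import Defs
open import Data.Nat using (ℕ; zero; suc; _+_; _⊔_; _≤_; z≤n; s≤s)
open import Data.Nat.Properties using (⊔-lub; ≤-reflexive; ≤-trans; +-suc)
open import Data.Fin using (Fin; zero; suc; _↑ˡ_)
open import Data.Fin.Properties using (_≟_)
open import Data.Fin.Subset using (Subset; _∈_; _∉_; ∣_∣)
open import Data.Vec.Base using (_∷_; here; there)
open import Data.Vec.Functional using (foldr) renaming (_∷_ to _◂_)
open import Data.Bool using (Bool; true; false)
import Data.Bool.Properties as Bool
open import Data.Product using (Σ; _×_; _,_; proj₁; proj₂)
open import Data.Product.Function.NonDependent.Propositional using (_×-⇔_)
open import Data.Sum using (_⊎_; inj₁; inj₂)
open import Data.Empty using (⊥-elim)
open import Function using (_∘_)
open import Function.Bundles using (_⇔_; mk⇔; Equivalence; mk↔ₛ′)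
import Function.Properties.Equivalence as ⇔
open import Function.Related.TypeIsomorphisms using (→-cong-⇔)
open import Relation.Nullary
  using (¬_; Dec; yes; no; does; proof; ¬?; _×-dec_; _⊎-dec_; Reflects; ofʸ; ofⁿ; invert)
open import Relation.Nullary.Decidable using (dec-true)
open import Relation.Binary.PropositionalEquality
  using (_≡_; _≢_; refl; sym; trans; cong; cong₂; subst; _≗_)

open Equivalence using (to; from)

≟-true⇒≡ : ∀ {n} {a b : Fin n} → does (a ≟ b) ≡ true → a ≡ b
≟-true⇒≡ {a = a} {b} e = invert (subst (Reflects (a ≡ b)) e (proof (a ≟ b)))

Π-cong-⇔ : ∀ {I : Set} {A B : I → Set} → (∀ i → A i ⇔ B i) → (∀ i → A i) ⇔ (∀ i → B i)
Π-cong-⇔ A⇔B = mk⇔ (λ a i → to (A⇔B i) (a i)) (λ b i → from (A⇔B i) (b i))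

Σ-cong-⇔ : ∀ {I : Set} {A B : I → Set} → (∀ i → A i ⇔ B i) → Σ I A ⇔ Σ I B
Σ-cong-⇔ A⇔B = mk⇔ (λ (i , a) → i , to (A⇔B i) a) (λ (i , b) → i , from (A⇔B i) b)

≡true-reflects : ∀ b → Reflects (b ≡ true) b
≡true-reflects true  = ofʸ refl
≡true-reflects false = ofⁿ λ ()

foldr-preserves : ∀ {A : Set} (P : A → Set) {_∙_ : A → A → A} {e : A}
  → (∀ {x y} → P x → P y → P (x ∙ y)) → P e
  → ∀ {n} (xs : Fin n → A) → (∀ i → P (xs i)) → P (foldr _∙_ e xs)
foldr-preserves P ∙-pres e-pres {zero}  xs pxs = e-pres
foldr-preserves P ∙-pres e-pres {suc n} xs pxs =
  ∙-pres (pxs zero) (foldr-preserves P ∙-pres e-pres (xs ∘ suc) (pxs ∘ suc))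

QF⇒NegFree : ∀ {k} {φ : Formula k} → QF φ → NegFree φ
QF⇒NegFree (qf-eq i j)  = nf-eq i j
QF⇒NegFree (qf-adj i j) = nf-adj i j
QF⇒NegFree (qf-neg q)   = nf-neg q
QF⇒NegFree (qf-and p q) = nf-and (QF⇒NegFree p) (QF⇒NegFree q)
QF⇒NegFree (qf-or p q)  = nf-or (QF⇒NegFree p) (QF⇒NegFree q)

QF-depth : ∀ {k} {φ : Formula k} → QF φ → depth φ ≡ 0
QF-depth (qf-eq i j)  = refl
QF-depth (qf-adj i j) = refl
QF-depth (qf-neg q)   = QF-depth q
QF-depth (qf-and p q) = cong₂ _⊔_ (QF-depth p) (QF-depth q)
QF-depth (qf-or p q)  = cong₂ _⊔_ (QF-depth p) (QF-depth q)

QF-altFrom : ∀ q {k} {φ : Formula k} → QF φ → altFrom q φ ≡ 0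
QF-altFrom q (qf-eq i j)  = refl
QF-altFrom q (qf-adj i j) = refl
QF-altFrom q (qf-neg p)   = QF-altFrom q p
QF-altFrom q (qf-and p r) = cong₂ _⊔_ (QF-altFrom q p) (QF-altFrom q r)
QF-altFrom q (qf-or p r)  = cong₂ _⊔_ (QF-altFrom q p) (QF-altFrom q r)

-- Π₁ d and Σ₂ d: negation-free ∀*- and ∃*∀*-formulas, not necessarily prenex, of
-- quantifier depth at most d.
data Π₁ : ∀ {k} → ℕ → Formula k → Set where
  π-qf  : ∀ {k d} {φ : Formula k} → QF φ → Π₁ d φ
  π-and : ∀ {k d} {φ ψ : Formula k} → Π₁ d φ → Π₁ d ψ → Π₁ d (and φ ψ)
  π-or  : ∀ {k d} {φ ψ : Formula k} → Π₁ d φ → Π₁ d ψ → Π₁ d (or φ ψ)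
  π-all : ∀ {k d} {φ : Formula (suc k)} → Π₁ d φ → Π₁ (suc d) (all φ)

data Σ₂ : ∀ {k} → ℕ → Formula k → Set where
  σ-π₁  : ∀ {k d} {φ : Formula k} → Π₁ d φ → Σ₂ d φ
  σ-and : ∀ {k d} {φ ψ : Formula k} → Σ₂ d φ → Σ₂ d ψ → Σ₂ d (and φ ψ)
  σ-ex  : ∀ {k d} {φ : Formula (suc k)} → Σ₂ d φ → Σ₂ (suc d) (ex φ)

Π₁⇒NegFree : ∀ {k d} {φ : Formula k} → Π₁ d φ → NegFree φ
Π₁⇒NegFree (π-qf q)    = QF⇒NegFree q
Π₁⇒NegFree (π-and p q) = nf-and (Π₁⇒NegFree p) (Π₁⇒NegFree q)
Π₁⇒NegFree (π-or p q)  = nf-or (Π₁⇒NegFree p) (Π₁⇒NegFree q)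
Π₁⇒NegFree (π-all p)   = nf-all (Π₁⇒NegFree p)

Π₁-depth : ∀ {k d} {φ : Formula k} → Π₁ d φ → depth φ ≤ d
Π₁-depth (π-qf q)    = ≤-trans (≤-reflexive (QF-depth q)) z≤n
Π₁-depth (π-and p q) = ⊔-lub (Π₁-depth p) (Π₁-depth q)
Π₁-depth (π-or p q)  = ⊔-lub (Π₁-depth p) (Π₁-depth q)
Π₁-depth (π-all p)   = s≤s (Π₁-depth p)

Π₁-altFrom-allQ : ∀ {k d} {φ : Formula k} → Π₁ d φ → altFrom allQ φ ≡ 0
Π₁-altFrom-allQ (π-qf q)    = QF-altFrom allQ q
Π₁-altFrom-allQ (π-and p q) = cong₂ _⊔_ (Π₁-altFrom-allQ p) (Π₁-altFrom-allQ q)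
Π₁-altFrom-allQ (π-or p q)  = cong₂ _⊔_ (Π₁-altFrom-allQ p) (Π₁-altFrom-allQ q)
Π₁-altFrom-allQ (π-all p)   = Π₁-altFrom-allQ p

Π₁-altFrom : ∀ q {k d} {φ : Formula k} → Π₁ d φ → altFrom q φ ≤ 1
Π₁-altFrom q    (π-qf p)    = ≤-trans (≤-reflexive (QF-altFrom q p)) z≤n
Π₁-altFrom q    (π-and p r) = ⊔-lub (Π₁-altFrom q p) (Π₁-altFrom q r)
Π₁-altFrom q    (π-or p r)  = ⊔-lub (Π₁-altFrom q p) (Π₁-altFrom q r)
Π₁-altFrom none (π-all p)   = ≤-trans (≤-reflexive (Π₁-altFrom-allQ p)) z≤n
Π₁-altFrom exQ  (π-all p)   = s≤s (≤-reflexive (Π₁-altFrom-allQ p))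
Π₁-altFrom allQ (π-all p)   = ≤-trans (≤-reflexive (Π₁-altFrom-allQ p)) z≤n

Σ₂⇒NegFree : ∀ {k d} {φ : Formula k} → Σ₂ d φ → NegFree φ
Σ₂⇒NegFree (σ-π₁ p)    = Π₁⇒NegFree p
Σ₂⇒NegFree (σ-and p q) = nf-and (Σ₂⇒NegFree p) (Σ₂⇒NegFree q)
Σ₂⇒NegFree (σ-ex p)    = nf-ex (Σ₂⇒NegFree p)

Σ₂-depth : ∀ {k d} {φ : Formula k} → Σ₂ d φ → depth φ ≤ d
Σ₂-depth (σ-π₁ p)    = Π₁-depth p
Σ₂-depth (σ-and p q) = ⊔-lub (Σ₂-depth p) (Σ₂-depth q)
Σ₂-depth (σ-ex p)    = s≤s (Σ₂-depth p)

Σ₂-altFrom : ∀ q → q ≢ allQ → ∀ {k d} {φ : Formula k} → Σ₂ d φ → altFrom q φ ≤ 1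
Σ₂-altFrom q    q≢∀ (σ-π₁ p)    = Π₁-altFrom q p
Σ₂-altFrom q    q≢∀ (σ-and p r) = ⊔-lub (Σ₂-altFrom q q≢∀ p) (Σ₂-altFrom q q≢∀ r)
Σ₂-altFrom none q≢∀ (σ-ex p)    = Σ₂-altFrom exQ (λ ()) p
Σ₂-altFrom exQ  q≢∀ (σ-ex p)    = Σ₂-altFrom exQ (λ ()) p
Σ₂-altFrom allQ q≢∀ (σ-ex p)    = ⊥-elim (q≢∀ refl)

Σ₂-defining⇒D₁≤ : ∀ {G d} {A : Sentence} → Σ₂ d A → Defines A G → D₁≤ G d
Σ₂-defining⇒D₁≤ {A = A} A∈Σ₂ A-defines =
  A , Σ₂⇒NegFree A∈Σ₂ , Σ₂-altFrom none (λ ()) A∈Σ₂ , Σ₂-depth A∈Σ₂ , A-defines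

lit : ∀ {k} → Bool → Formula k → Formula k
lit true  φ = φ
lit false φ = neg φ

lit-QF : ∀ {k} β {φ : Formula k} → QF φ → QF (lit β φ)
lit-QF true  q = q
lit-QF false q = qf-neg q

_⇒ᶠ_ : ∀ {k} → Formula k → Formula k → Formula k
φ ⇒ᶠ ψ = or (neg φ) ψ

exPrefix : ∀ m {k} → Formula (m + k) → Formula k
exPrefix zero    φ = φ
exPrefix (suc m) φ = exPrefix m (ex φ)

prepend : ∀ {N} m {k} → (Fin m → Fin N) → (Fin k → Fin N) → Fin (m + k) → Fin N
prepend zero    τ ρ = ρ
prepend (suc m) τ ρ = extend (prepend m (τ ∘ suc) ρ) (τ zero)

prepend-↑ˡ : ∀ {N} m {k} (τ : Fin m → Fin N) (ρ : Fin k → Fin N) i → prepend m τ ρ (i ↑ˡ k) ≡ τ i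
prepend-↑ˡ (suc m) τ ρ zero    = refl
prepend-↑ˡ (suc m) τ ρ (suc i) = prepend-↑ˡ m (τ ∘ suc) ρ i

Σ₂-exPrefix : ∀ m {k d} {φ : Formula (m + k)} → Σ₂ d φ → Σ₂ (m + d) (exPrefix m φ)
Σ₂-exPrefix zero    p = p
Σ₂-exPrefix (suc m) {d = d} {φ} p =
  subst (λ e → Σ₂ e (exPrefix m (ex φ))) (+-suc m d) (Σ₂-exPrefix m (σ-ex p))

module _ (H : Graph) where

  Sat? : ∀ {k} {φ : Formula k} → QF φ → ∀ ρ → Dec (Sat H φ ρ)
  Sat? (qf-eq i j)  ρ = ρ i ≟ ρ j
  Sat? (qf-adj i j) ρ = adj H (ρ i) (ρ j) Bool.≟ true
  Sat? (qf-neg q)   ρ = ¬? (Sat? q ρ)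
  Sat? (qf-and p q) ρ = Sat? p ρ ×-dec Sat? q ρ
  Sat? (qf-or p q)  ρ = Sat? p ρ ⊎-dec Sat? q ρ

  Sat-lit : ∀ {k} {φ : Formula k} {ρ b} → Reflects (Sat H φ ρ) b → ∀ β → Sat H (lit β φ) ρ ⇔ b ≡ β
  Sat-lit (ofʸ s)  true  = mk⇔ (λ _ → refl) (λ _ → s)
  Sat-lit (ofʸ s)  false = mk⇔ (λ ¬s → ⊥-elim (¬s s)) (λ ())
  Sat-lit (ofⁿ ¬s) true  = mk⇔ (λ s → ⊥-elim (¬s s)) (λ ())
  Sat-lit (ofⁿ ¬s) false = mk⇔ (λ _ → refl) (λ _ → ¬s)

  Sat-⇒ᶠ : ∀ {k} {φ ψ : Formula k} {ρ} → Dec (Sat H ψ ρ)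
    → Sat H (φ ⇒ᶠ ψ) ρ ⇔ (Sat H φ ρ → Sat H ψ ρ)
  Sat-⇒ᶠ ψ? = mk⇔ (λ { (inj₁ ¬sφ) sφ → ⊥-elim (¬sφ sφ) ; (inj₂ sψ) _ → sψ }) (implication ψ?)
    where
    implication : ∀ {A B : Set} → Dec B → (A → B) → ¬ A ⊎ B
    implication (yes b) _   = inj₂ b
    implication (no ¬b) a→b = inj₁ (¬b ∘ a→b)

  Sat-foldr-and : ∀ {k n} {φ₀ : Formula k} {ρ} → Sat H φ₀ ρ → (φs : Fin n → Formula k)
    → Sat H (foldr and φ₀ φs) ρ ⇔ (∀ i → Sat H (φs i) ρ)
  Sat-foldr-and {n = zero}  s₀ φs = mk⇔ (λ _ ()) (λ _ → s₀)
  Sat-foldr-and {n = suc n} s₀ φs = mk⇔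
    (λ (s , ss) → λ { zero → s ; (suc i) → to IH ss i })
    (λ ss → ss zero , from IH (ss ∘ suc))
    where IH = Sat-foldr-and s₀ (φs ∘ suc)

  Sat-foldr-or : ∀ {k n} {φ₀ : Formula k} {ρ} → ¬ Sat H φ₀ ρ → (φs : Fin n → Formula k)
    → Sat H (foldr or φ₀ φs) ρ ⇔ Σ (Fin n) λ i → Sat H (φs i) ρ
  Sat-foldr-or {n = zero}  ¬s₀ φs = mk⇔ (⊥-elim ∘ ¬s₀) λ ()
  Sat-foldr-or {n = suc n} ¬s₀ φs = mk⇔
    (λ { (inj₁ s) → zero , s ; (inj₂ ss) → let i , s = to IH ss in suc i , s })
    (λ { (zero , s) → inj₁ s ; (suc i , s) → inj₂ (from IH (i , s)) })
    where IH = Sat-foldr-or ¬s₀ (φs ∘ suc)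

  Sat-exPrefix : ∀ m {k} (φ : Formula (m + k)) ρ
    → Sat H (exPrefix m φ) ρ ⇔ Σ (Fin m → Fin (order H)) λ τ → Sat H φ (prepend m τ ρ)
  Sat-exPrefix zero    φ ρ = mk⇔ (λ s → (λ ()) , s) proj₂
  Sat-exPrefix (suc m) φ ρ = mk⇔
    (λ s → let τ , v , s′ = to IH s in v ◂ τ , s′)
    (λ (τ , s) → from IH (τ ∘ suc , τ zero , s))
    where IH = Sat-exPrefix m (ex φ) ρ

enumerate : ∀ {n} (p : Subset n) → Fin ∣ p ∣ → Fin n
enumerate (true ∷ p)  zero    = zero
enumerate (true ∷ p)  (suc i) = suc (enumerate p i)
enumerate (false ∷ p) i       = suc (enumerate p i)

enumerate-∈ : ∀ {n} (p : Subset n) i → enumerate p i ∈ p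
enumerate-∈ (true ∷ p)  zero    = here
enumerate-∈ (true ∷ p)  (suc i) = there (enumerate-∈ p i)
enumerate-∈ (false ∷ p) i       = there (enumerate-∈ p i)

enumerate-onto : ∀ {n} (p : Subset n) {x} → x ∈ p → Σ (Fin ∣ p ∣) λ i → enumerate p i ≡ x
enumerate-onto (true ∷ p) here = zero , refl
enumerate-onto (true ∷ p) (there x∈p) =
  let i , e = enumerate-onto p x∈p in suc i , cong suc e
enumerate-onto (false ∷ p) (there x∈p) =
  let i , e = enumerate-onto p x∈p in i , cong suc e

module _ (G : Graph) {X : Subset (order G)} where

  EquivX-sym : ∀ {x y} → EquivX G X x y → EquivX G X y x
  EquivX-sym (inj₁ x≡y)            = inj₁ (sym x≡y)
  EquivX-sym (inj₂ (x∉ , y∉ , agree)) = inj₂ (y∉ , x∉ , λ z z∈X → sym (agree z z∈X))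

  InS-unique : ∀ {w y} → InS G X y → EquivX G X w y → w ≡ y
  InS-unique {w} {y} y∈S w≡Xy with w ≟ y
  ... | yes w≡y = w≡y
  ... | no  w≢y = ⊥-elim (y∈S (w , w≢y , w≡Xy))

record SameAtoms (H G : Graph) (a a′ : Fin (order H)) (v v′ : Fin (order G)) : Set where
  constructor sameAtoms
  field
    same-≟   : does (a ≟ a′) ≡ does (v ≟ v′)
    same-adj : adj H a a′ ≡ adj G v v′

SameAtoms-sym : ∀ {H G a a′ v v′} → SameAtoms H G a a′ v v′ → SameAtoms G H v v′ a a′
SameAtoms-sym (sameAtoms e e′) = sameAtoms (sym e) (sym e′)

SameAtoms-trans : ∀ {H G K a a′ v v′ w w′}
  → SameAtoms H G a a′ v v′ → SameAtoms G K v v′ w w′ → SameAtoms H K a a′ w w′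
SameAtoms-trans (sameAtoms e₁ e₁′) (sameAtoms e₂ e₂′) = sameAtoms (trans e₁ e₂) (trans e₁′ e₂′)

module _ (G : Graph) where

  sameAtomsᶠ : ∀ {k} → Fin k → Fin k → Fin (order G) → Fin (order G) → Formula k
  sameAtomsᶠ u u′ v v′ = and (lit (does (v ≟ v′)) (eq u u′)) (lit (adj G v v′) (adjF u u′))

  sameAtomsᶠ-QF : ∀ {k} (u u′ : Fin k) v v′ → QF (sameAtomsᶠ u u′ v v′)
  sameAtomsᶠ-QF u u′ v v′ = qf-and (lit-QF _ (qf-eq u u′)) (lit-QF _ (qf-adj u u′))

  Sat-sameAtomsᶠ : ∀ (H : Graph) {k} (u u′ : Fin k) v v′ ρ
    → Sat H (sameAtomsᶠ u u′ v v′) ρ ⇔ SameAtoms H G (ρ u) (ρ u′) v v′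
  Sat-sameAtomsᶠ H u u′ v v′ ρ = ⇔.trans
    (Sat-lit H (proof (ρ u ≟ ρ u′)) _ ×-⇔ Sat-lit H (≡true-reflects (adj H (ρ u) (ρ u′))) _)
    (mk⇔ (λ (e , e′) → sameAtoms e e′) (λ (sameAtoms e e′) → e , e′))

module Representation (G : Graph) (X Y : Subset (order G)) where

  V : Set
  V = Fin (order G)

  ξ : Fin ∣ X ∣ → V
  ξ = enumerate X

  υ : Fin ∣ Y ∣ → V
  υ = enumerate Y

  module _ (H : Graph) (η : Fin ∣ X ∣ → Fin (order H)) where

    SameType : Fin (order H) → V → Set
    SameType a v = ∀ i → SameAtoms H G a (η i) v (ξ i)

    Represents : Fin (order H) → V → Set
    Represents a v = SameType a v × (∀ w j → SameType w (υ j) → adj H a w ≡ adj G v (υ j))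

    Covers : Set
    Covers = ∀ v → Σ (Fin (order H)) λ a → Represents a v

    PairsRepresented : Set
    PairsRepresented = ∀ a a′ → Σ V λ v → Σ V λ v′ →
      Represents a v × Represents a′ v′ × SameAtoms H G a a′ v v′

  sameTypeᶠ : ∀ {k} → (Fin ∣ X ∣ → Fin k) → Fin k → V → Formula k
  sameTypeᶠ xv u v = foldr and (eq u u) λ i → sameAtomsᶠ G u (xv i) v (ξ i)

  representsᶠ : ∀ {k} → (Fin ∣ X ∣ → Fin k) → Fin k → V → Formula k
  representsᶠ xv u v = and (sameTypeᶠ xv u v) (all (foldr and (eq zero zero) λ j →
    sameTypeᶠ (suc ∘ xv) zero (υ j) ⇒ᶠ lit (adj G v (υ j)) (adjF (suc u) zero)))

  -- Without free variables (X = ∅) no quantifier-free formula is true, hence the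
  -- quantified unit of this conjunction.
  coversᶠ : ∀ {k} → (Fin ∣ X ∣ → Fin k) → Formula k
  coversᶠ xv = foldr and (all (eq zero zero)) λ v → ex (representsᶠ (suc ∘ xv) zero v)

  pairsᶠ : ∀ {k} → (Fin ∣ X ∣ → Fin k) → Formula k
  pairsᶠ xv = all (all (foldr or (neg (eq zero zero)) λ v → foldr or (neg (eq zero zero)) λ v′ →
    and (representsᶠ xv″ (suc zero) v)
        (and (representsᶠ xv″ zero v′) (sameAtomsᶠ G (suc zero) zero v v′))))
    where
    xv″ : Fin ∣ X ∣ → Fin (suc (suc _))
    xv″ i = suc (suc (xv i))

  parameters : Fin ∣ X ∣ → Fin (∣ X ∣ + 0)
  parameters i = i ↑ˡ 0

  sentence : Sentence
  sentence = exPrefix ∣ X ∣ (and (coversᶠ parameters) (pairsᶠ parameters))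

  sameTypeᶠ-QF : ∀ {k} (xv : Fin ∣ X ∣ → Fin k) u v → QF (sameTypeᶠ xv u v)
  sameTypeᶠ-QF xv u v =
    foldr-preserves QF qf-and (qf-eq u u) _ λ i → sameAtomsᶠ-QF G u (xv i) v (ξ i)

  representsᶠ-Π₁ : ∀ {k d} (xv : Fin ∣ X ∣ → Fin k) u v → Π₁ (suc d) (representsᶠ xv u v)
  representsᶠ-Π₁ xv u v = π-and (π-qf (sameTypeᶠ-QF xv u v)) (π-all (π-qf
    (foldr-preserves QF qf-and (qf-eq zero zero) _ λ j →
      qf-or (qf-neg (sameTypeᶠ-QF _ zero (υ j))) (lit-QF _ (qf-adj (suc u) zero)))))

  sentence-Σ₂ : Σ₂ (∣ X ∣ + 3) sentence
  sentence-Σ₂ = Σ₂-exPrefix ∣ X ∣ (σ-and covers-Σ₂ (σ-π₁ pairs-Π₁))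
    where
    covers-Σ₂ : Σ₂ 3 (coversᶠ parameters)
    covers-Σ₂ = foldr-preserves (Σ₂ 3) σ-and (σ-π₁ (π-all (π-qf (qf-eq zero zero)))) _ λ v →
      σ-ex (σ-π₁ (representsᶠ-Π₁ _ zero v))
    pairs-Π₁ : Π₁ 3 (pairsᶠ parameters)
    pairs-Π₁ = π-all (π-all
      (foldr-preserves (Π₁ 1) π-or (π-qf (qf-neg (qf-eq zero zero))) _ λ v →
       foldr-preserves (Π₁ 1) π-or (π-qf (qf-neg (qf-eq zero zero))) _ λ v′ →
       π-and (representsᶠ-Π₁ _ (suc zero) v)
             (π-and (representsᶠ-Π₁ _ zero v′) (π-qf (sameAtomsᶠ-QF G (suc zero) zero v v′)))))

  module _ (H : Graph) where

    Sat-sameTypeᶠ : ∀ {k} (xv : Fin ∣ X ∣ → Fin k) u v ρ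
      → Sat H (sameTypeᶠ xv u v) ρ ⇔ SameType H (ρ ∘ xv) (ρ u) v
    Sat-sameTypeᶠ xv u v ρ = ⇔.trans (Sat-foldr-and H refl _)
      (Π-cong-⇔ λ i → Sat-sameAtomsᶠ G H u (xv i) v (ξ i) ρ)

    Sat-representsᶠ : ∀ {k} (xv : Fin ∣ X ∣ → Fin k) u v ρ
      → Sat H (representsᶠ xv u v) ρ ⇔ Represents H (ρ ∘ xv) (ρ u) v
    Sat-representsᶠ xv u v ρ = Sat-sameTypeᶠ xv u v ρ ×-⇔ Π-cong-⇔ λ w →
      ⇔.trans (Sat-foldr-and H refl _) (Π-cong-⇔ λ j →
        ⇔.trans (Sat-⇒ᶠ H (Sat? H (lit-QF _ (qf-adj (suc u) zero)) (extend ρ w)))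
                (→-cong-⇔ (Sat-sameTypeᶠ (suc ∘ xv) zero (υ j) (extend ρ w))
                          (Sat-lit H (≡true-reflects (adj H (ρ u) w)) _)))

    Sat-coversᶠ : ∀ {k} (xv : Fin ∣ X ∣ → Fin k) ρ → Sat H (coversᶠ xv) ρ ⇔ Covers H (ρ ∘ xv)
    Sat-coversᶠ xv ρ = ⇔.trans (Sat-foldr-and H (λ _ → refl) _) (Π-cong-⇔ λ v →
      Σ-cong-⇔ λ a → Sat-representsᶠ (suc ∘ xv) zero v (extend ρ a))

    Sat-pairsᶠ : ∀ {k} (xv : Fin ∣ X ∣ → Fin k) ρ
      → Sat H (pairsᶠ xv) ρ ⇔ PairsRepresented H (ρ ∘ xv)
    Sat-pairsᶠ xv ρ = Π-cong-⇔ λ a → Π-cong-⇔ λ a′ → let σ = extend (extend ρ a) a′ in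
      ⇔.trans (Sat-foldr-or H (λ ¬r → ¬r refl) _) (Σ-cong-⇔ λ v →
      ⇔.trans (Sat-foldr-or H (λ ¬r → ¬r refl) _) (Σ-cong-⇔ λ v′ →
        Sat-representsᶠ _ (suc zero) v σ ×-⇔ Sat-representsᶠ _ zero v′ σ
          ×-⇔ Sat-sameAtomsᶠ G H (suc zero) zero v v′ σ))

  sameType⇒EquivX : ∀ {a b} → SameType G ξ a b → EquivX G X a b
  sameType⇒EquivX {a} {b} t with a ≟ b
  ... | yes a≡b = inj₁ a≡b
  ... | no  a≢b = inj₂ ((λ a∈X → a≢b (sym (pinned (SameAtoms.same-≟ ∘ t) a∈X)))
                      , (λ b∈X → a≢b (pinned (sym ∘ SameAtoms.same-≟ ∘ t) b∈X))
                      , same-adj)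
    where
    pinned : ∀ {c d} → (∀ i → does (c ≟ ξ i) ≡ does (d ≟ ξ i)) → c ∈ X → d ≡ c
    pinned same-≟ c∈X with enumerate-onto X c∈X
    ... | i , refl = ≟-true⇒≡ (trans (sym (same-≟ i)) (dec-true (ξ i ≟ ξ i) refl))
    same-adj : ∀ z → z ∈ X → adj G a z ≡ adj G b z
    same-adj z z∈X with enumerate-onto X z∈X
    ... | i , refl = SameAtoms.same-adj (t i)

  module _ (Y⊆S[X] : ∀ y → y ∈ Y → InS G X y) where

    sameType-unique-on-Y : ∀ {w} j → SameType G ξ w (υ j) → w ≡ υ j
    sameType-unique-on-Y j t = InS-unique G (Y⊆S[X] _ (enumerate-∈ Y j)) (sameType⇒EquivX t)

    represents-self : ∀ {η} → η ≗ ξ → ∀ v → Represents G η v v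
    represents-self η≗ξ v = self-type , λ w j t → cong (adj G v) (sameType-unique-on-Y j λ i →
      subst (λ x → SameAtoms G G w x (υ j) (ξ i)) (η≗ξ i) (t i))
      where
      self-type : SameType G _ v v
      self-type i = subst (λ x → SameAtoms G G v x v (ξ i)) (sym (η≗ξ i)) (sameAtoms refl refl)

    G⊨sentence : G ⊨ sentence
    G⊨sentence = from (Sat-exPrefix G ∣ X ∣ _ noVars)
      (ξ , from (Sat-coversᶠ G parameters ρ) covers , from (Sat-pairsᶠ G parameters ρ) pairs)
      where
      ρ : Fin (∣ X ∣ + 0) → V
      ρ = prepend ∣ X ∣ ξ noVars
      η≗ξ : ρ ∘ parameters ≗ ξ
      η≗ξ = prepend-↑ˡ ∣ X ∣ ξ noVars
      covers : Covers G (ρ ∘ parameters)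
      covers v = v , represents-self η≗ξ v
      pairs : PairsRepresented G (ρ ∘ parameters)
      pairs a a′ = a , a′ , represents-self η≗ξ a , represents-self η≗ξ a′ , sameAtoms refl refl

    module _ (S[Y]≡V : ∀ v → InS G Y v) where

      module _ {H : Graph} {η : Fin ∣ X ∣ → Fin (order H)} (covers : Covers H η) where

        represents-functional : ∀ {a v v′} → Represents H η a v → Represents H η a v′ → v ≡ v′
        represents-functional {a} {v} {v′} (t , r) (t′ , r′) with v ≟ v′
        ... | yes v≡v′ = v≡v′
        ... | no  v≢v′ = ⊥-elim (S[Y]≡V v (v′ , v≢v′ ∘ sym , inj₂ (v′∉Y , v∉Y , same-adj)))
          where
          v≡Xv′ : EquivX G X v v′
          v≡Xv′ = sameType⇒EquivX λ i → SameAtoms-trans (SameAtoms-sym (t i)) (t′ i)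
          v∉Y : v ∉ Y
          v∉Y v∈Y = v≢v′ (sym (InS-unique G (Y⊆S[X] v v∈Y) (EquivX-sym G v≡Xv′)))
          v′∉Y : v′ ∉ Y
          v′∉Y v′∈Y = v≢v′ (InS-unique G (Y⊆S[X] v′ v′∈Y) v≡Xv′)
          same-adj : ∀ z → z ∈ Y → adj G v′ z ≡ adj G v z
          same-adj z z∈Y with enumerate-onto Y z∈Y
          ... | j , refl = let w , tw , _ = covers (υ j) in trans (sym (r′ w j tw)) (r w j tw)

        representation-≅ : PairsRepresented H η → H ≅ G
        representation-≅ pairs = record { bij = mk↔ₛ′ g f g∘f f∘g ; preserve = preserve }
          where
          g : Fin (order H) → V
          g a = proj₁ (pairs a a)
          g-represents : ∀ a → Represents H η a (g a)
          g-represents a = proj₁ (proj₂ (proj₂ (pairs a a)))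
          f : V → Fin (order H)
          f v = proj₁ (covers v)
          f-represents : ∀ v → Represents H η (f v) v
          f-represents v = proj₂ (covers v)
          g∘f : ∀ v → g (f v) ≡ v
          g∘f v = represents-functional (g-represents (f v)) (f-represents v)
          -- f (g a) and a both represent g a, and pairs reflects this equality back to H.
          f∘g : ∀ a → f (g a) ≡ a
          f∘g a = let v , v′ , rv , rv′ , sameAtoms same-≟ _ = pairs (f (g a)) a in
            ≟-true⇒≡ (trans same-≟ (dec-true (v ≟ v′)
              (trans (sym (represents-functional (f-represents (g a)) rv))
                     (represents-functional (g-represents a) rv′))))
          preserve : ∀ a a′ → adj G (g a) (g a′) ≡ adj H a a′
          preserve a a′ = let v , v′ , rv , rv′ , sameAtoms _ same-adj = pairs a a′ in
            trans (cong₂ (adj G) (represents-functional (g-represents a) rv)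
                                 (represents-functional (g-represents a′) rv′))
                  (sym same-adj)

      sentence-defines : Defines sentence G
      sentence-defines = G⊨sentence , λ H H≇G H⊨sentence →
        let _ , c , p = to (Sat-exPrefix H ∣ X ∣ _ noVars) H⊨sentence in
        H≇G (representation-≅ (to (Sat-coversᶠ H parameters _) c)
                              (to (Sat-pairsᶠ H parameters _) p))

-- Only the inclusion Y ⊆ S(X) of the hypothesis Y = S(X) is needed.
lemma3p8 : (G : Graph) (X Y : Subset (order G))
    → (∀ x → (x ∈ Y → InS G X x) × (InS G X x → x ∈ Y))
    → (∀ x → InS G Y x)
    → D₁≤ G (∣ X ∣ + 3)
lemma3p8 G X Y Y≡S[X] S[Y]≡V =
  Σ₂-defining⇒D₁≤ sentence-Σ₂ (sentence-defines (λ y → proj₁ (Y≡S[X] y)) S[Y]≡V)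
  where open Representation G X Y
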